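{- Let $H$ be a schematic extended Herbrand-sequent and define $C_1=\bigwedge_{i=1}^m F\{x\mapsto u_i\}$ and $C_{i+1}=\bigwedge_{j=1}^{k_i}C_i\{\alpha_i\mapsto s_{i,j}\}$ for $i=1,\ldots,n$. Then $C_{n+1}\rightarrow$ is a tautology.
   Context: Fix a quantifier-free $F$ with one free variable $x$; $A\{x\mapsto t\}$ denotes substitution. A schematic extended Herbrand-sequent of $\forall x\,F\rightarrow$ is a sequent $H=F\{x\mapsto u_1\},\ldots,F\{x\mapsto u_m\},X_1(\alpha_1)\supset\bigwedge_{j=1}^{k_1}X_1(s_{1,j}),\ldots,X_n(\alpha_n)\supset\bigwedge_{j=1}^{k_n}X_n(s_{n,j})\rightarrow$ with $X_i$ monadic second-order variables, $\alpha_i$ variables, terms $s_{i,j}$ with variables among $\alpha_{i+1},\ldots,\alpha_n$, such that $\bigwedge_{t\in L(\mathrm{G}(H))}F\{x\mapsto t\}\rightarrow$ is a tautology. Here $\mathrm{G}(H)$ is the totally rigid grammar with non-terminals $\tau,\alpha_1,\ldots,\alpha_n$, start symbol $\tau$ and productions $\tau\to u_i$ ($1\le i\le m$) and $\alpha_i\to s_{i,j}$, and $L(\mathrm{G}(H))=\{u_i\{\alpha_1\mapsto s_{1,j_1}\}\cdots\{\alpha_n\mapsto s_{n,j_n}\}\}$. -}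

module Defs where

open import Data.Nat using (ℕ; _≟_)
open import Data.Bool using (Bool; true; false; _∧_; _∨_; not)
open import Data.List using (List; []; _∷_; map; concatMap; [_])
open import Data.List.Relation.Unary.All using (All)
open import Data.List.Relation.Unary.Any using (Any)
open import Data.List.Membership.Propositional using (_∈_)
open import Data.Product using (_×_; _,_; proj₁)
open import Data.Unit using (⊤)
open import Relation.Nullary using (yes; no)
open import Relation.Binary.PropositionalEquality using (_≡_)

data Term (Fun : Set) : Set where
  var : ℕ → Term Fun
  app : Fun → List (Term Fun) → Term Fun

data Formula (Fun Pred : Set) : Set where
  atom : Pred → List (Term Fun) → Formula Fun Pred
  ⊤ᶠ ⊥ᶠ : Formula Fun Pred
  ¬ᶠ_ : Formula Fun Pred → Formula Fun Pred
  _∧ᶠ_ _∨ᶠ_ _⊃ᶠ_ : Formula Fun Pred → Formula Fun Pred → Formula Fun Pred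

module _ {Fun : Set} where

  mutual
    substT : ℕ → Term Fun → Term Fun → Term Fun
    substT y s (var z) with z ≟ y
    ... | yes _ = s
    ... | no _ = var z
    substT y s (app f ts) = app f (substTs y s ts)

    substTs : ℕ → Term Fun → List (Term Fun) → List (Term Fun)
    substTs y s [] = []
    substTs y s (t ∷ ts) = substT y s t ∷ substTs y s ts

  data _occursInT_ (y : ℕ) : Term Fun → Set where
    here : y occursInT var y
    arg  : ∀ {f ts t} → t ∈ ts → y occursInT t → y occursInT app f ts

module _ {Fun Pred : Set} where

  subst : ℕ → Term Fun → Formula Fun Pred → Formula Fun Pred
  subst y s (atom P ts) = atom P (substTs y s ts)
  subst y s ⊤ᶠ = ⊤ᶠ
  subst y s ⊥ᶠ = ⊥ᶠ
  subst y s (¬ᶠ A) = ¬ᶠ subst y s A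
  subst y s (A ∧ᶠ B) = subst y s A ∧ᶠ subst y s B
  subst y s (A ∨ᶠ B) = subst y s A ∨ᶠ subst y s B
  subst y s (A ⊃ᶠ B) = subst y s A ⊃ᶠ subst y s B

  data _occursIn_ (y : ℕ) : Formula Fun Pred → Set where
    inAtom : ∀ {P ts t} → t ∈ ts → y occursInT t → y occursIn atom P ts
    in¬  : ∀ {A} → y occursIn A → y occursIn (¬ᶠ A)
    in∧ˡ : ∀ {A B} → y occursIn A → y occursIn (A ∧ᶠ B)
    in∧ʳ : ∀ {A B} → y occursIn B → y occursIn (A ∧ᶠ B)
    in∨ˡ : ∀ {A B} → y occursIn A → y occursIn (A ∨ᶠ B)
    in∨ʳ : ∀ {A B} → y occursIn B → y occursIn (A ∨ᶠ B)
    in⊃ˡ : ∀ {A B} → y occursIn A → y occursIn (A ⊃ᶠ B)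
    in⊃ʳ : ∀ {A B} → y occursIn B → y occursIn (A ⊃ᶠ B)

  ⋀ : List (Formula Fun Pred) → Formula Fun Pred
  ⋀ [] = ⊤ᶠ
  ⋀ (A ∷ As) = A ∧ᶠ ⋀ As

  -- Propositional semantics: atoms (closed or not) are propositional variables.
  Valuation : Set
  Valuation = Pred → List (Term Fun) → Bool

  eval : Valuation → Formula Fun Pred → Bool
  eval v (atom P ts) = v P ts
  eval v ⊤ᶠ = true
  eval v ⊥ᶠ = false
  eval v (¬ᶠ A) = not (eval v A)
  eval v (A ∧ᶠ B) = eval v A ∧ eval v B
  eval v (A ∨ᶠ B) = eval v A ∨ eval v B
  eval v (A ⊃ᶠ B) = not (eval v A) ∨ eval v B

  -- The sequent  A →  (empty succedent) is a tautology.
  TautAnte : Formula Fun Pred → Set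
  TautAnte A = ∀ (v : Valuation) → eval v A ≡ false

-- Data of a schematic extended Herbrand-sequent.
-- A block (α_i , [s_{i,1}, …, s_{i,k_i}]); the list of blocks is
-- [(α_1, s_1), …, (α_n, s_n)].

Block : Set → Set
Block Fun = ℕ × List (Term Fun)

BlocksOK : {Fun : Set} → List (Block Fun) → Set
BlocksOK [] = ⊤
BlocksOK ((α , ss) ∷ rest) =
  All (λ s → ∀ y → y occursInT s → y ∈ map proj₁ rest) ss × BlocksOK rest

instances : {Fun : Set} → Term Fun → List (Block Fun) → List (Term Fun)
instances t [] = [ t ]
instances t ((α , ss) ∷ rest) = concatMap (λ s → instances (substT α s t) rest) ss

-- L(G(H)) for the totally rigid grammar τ → u_i, α_i → s_{i,j}
language : {Fun : Set} → List (Term Fun) → List (Block Fun) → List (Term Fun)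
language us bs = concatMap (λ u → instances u bs) us

record IsSchematicHerbrand {Fun Pred : Set} (F : Formula Fun Pred) (x : ℕ)
       (us : List (Term Fun)) (bs : List (Block Fun)) : Set where
  field
    blocksOK : BlocksOK bs
    taut     : TautAnte (⋀ (map (λ t → subst x t F) (language us bs)))

Cchain : {Fun Pred : Set} → Formula Fun Pred → List (Block Fun) → Formula Fun Pred
Cchain C [] = C
Cchain C ((α , ss) ∷ rest) = Cchain (⋀ (map (λ s → subst α s C) ss)) rest

C₁ : {Fun Pred : Set} → Formula Fun Pred → ℕ → List (Term Fun) → Formula Fun Pred
C₁ F x us = ⋀ (map (λ u → subst x u F) us)

module Submission where

-- Call a choice of one term s_{i,j_i} from every block a
-- selection c, and write tc (resp. Ac) for the result of applying the
-- substitutions {α_1 ↦ s_{1,j_1}}, …, {α_n ↦ s_{n,j_n}} in this order.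
-- Suppose a valuation v satisfies C_{n+1}.
--   1. Unfolding the recursion C_{i+1} = ⋀_j C_i{α_i ↦ s_{i,j}} block by
--      block, v satisfies C_1 c for every selection c (Cchain-sound).
--   2. C_1 c is the conjunction of the F{x ↦ u_i}c, and since x is the only
--      variable of F, F{x ↦ u}c = F{x ↦ uc} (instF-subst).
--   3. Every term of L(G(H)) has the form u_i c for some i and some
--      selection c (language-selection).
-- Hence v satisfies ⋀_{t ∈ L(G(H))} F{x ↦ t}, which no valuation does since
-- H is a schematic extended Herbrand-sequent; so C_{n+1} → is a tautology.

open import Defs
open import Data.Nat using (ℕ; _≟_)
open import Data.List using (List; []; _∷_; map)
open import Data.List.Relation.Unary.Any using (here; there)
open import Data.List.Membership.Propositional using (_∈_; find)
open import Data.List.Membership.Propositional.Properties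
  using (∈-map⁺; ∈-map⁻; ∈-concatMap⁻)
open import Data.Product using (∃-syntax; _×_; _,_)
open import Data.Unit using (tt) renaming (⊤ to Unit)
open import Data.Bool using (true)
open import Data.Bool.Properties using (∧-conicalˡ; ∧-conicalʳ; not-¬; ¬-not)
open import Relation.Nullary using (yes; no)
open import Relation.Binary.PropositionalEquality
  using (_≡_; refl; cong; cong₂)
  renaming (subst to transport)
open Relation.Binary.PropositionalEquality.≡-Reasoning

module _ {Fun Pred : Set} where

  _⊨_ : Valuation {Fun} {Pred} → Formula Fun Pred → Set
  v ⊨ A = eval v A ≡ true

  ⊨-⋀⁻ : ∀ {v} {Ds : List (Formula Fun Pred)} {D} → v ⊨ ⋀ Ds → D ∈ Ds → v ⊨ D
  ⊨-⋀⁻ {Ds = E ∷ Es} h (here refl) = ∧-conicalˡ _ _ h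
  ⊨-⋀⁻ {Ds = E ∷ Es} h (there D∈) = ⊨-⋀⁻ (∧-conicalʳ _ _ h) D∈

  ⊨-⋀⁺ : ∀ {v} (Ds : List (Formula Fun Pred)) → (∀ {D} → D ∈ Ds → v ⊨ D) → v ⊨ ⋀ Ds
  ⊨-⋀⁺ [] h = refl
  ⊨-⋀⁺ (D ∷ Ds) h rewrite h (here refl) = ⊨-⋀⁺ Ds (λ D∈ → h (there D∈))

module _ {Fun : Set} where

  Selection : List (Block Fun) → Set
  Selection [] = Unit
  Selection ((α , ss) ∷ rest) = (∃[ s ] s ∈ ss) × Selection rest

  instT : (bs : List (Block Fun)) → Selection bs → Term Fun → Term Fun
  instT [] _ t = t
  instT ((α , _) ∷ rest) ((s , _) , c) t = instT rest c (substT α s t)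

module _ {Fun Pred : Set} where

  instF : (bs : List (Block Fun)) → Selection bs → Formula Fun Pred → Formula Fun Pred
  instF [] _ A = A
  instF ((α , _) ∷ rest) ((s , _) , c) A = instF rest c (subst α s A)

  instF-∧ : ∀ bs c (A B : Formula Fun Pred)
          → instF bs c (A ∧ᶠ B) ≡ (instF bs c A ∧ᶠ instF bs c B)
  instF-∧ [] _ A B = refl
  instF-∧ ((α , _) ∷ rest) ((s , _) , c) A B = instF-∧ rest c (subst α s A) (subst α s B)

  ⊨-instF-⋀⁻ : ∀ {v} bs c (Ds : List (Formula Fun Pred)) {D}
             → v ⊨ instF bs c (⋀ Ds) → D ∈ Ds → v ⊨ instF bs c D
  ⊨-instF-⋀⁻ bs c (E ∷ Es) h D∈ rewrite instF-∧ bs c E (⋀ Es) with D∈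
  ... | here refl = ∧-conicalˡ _ _ h
  ... | there D∈Es = ⊨-instF-⋀⁻ bs c Es (∧-conicalʳ _ _ h) D∈Es

  Cchain-sound : ∀ {v} bs (C : Formula Fun Pred)
               → v ⊨ Cchain C bs → (c : Selection bs) → v ⊨ instF bs c C
  Cchain-sound [] C h _ = h
  Cchain-sound ((α , ss) ∷ rest) C h ((s , s∈ss) , c) =
    ⊨-instF-⋀⁻ rest c (map (λ s′ → subst α s′ C) ss)
      (Cchain-sound rest _ h c) (∈-map⁺ (λ s′ → subst α s′ C) s∈ss)

module _ {Fun : Set} where

  OnlyVarT : ℕ → Term Fun → Set
  OnlyVarT x t = ∀ y → y occursInT t → y ≡ x

  mutual
    substT-swap : ∀ x α s u (t : Term Fun) → OnlyVarT x t
                → substT α s (substT x u t) ≡ substT x (substT α s u) t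
    substT-swap x α s u (var z) only with z ≟ x
    ... | yes _ = refl
    ... | no z≢x with z≢x (only z here)
    ... | ()
    substT-swap x α s u (app f ts) only =
      cong (app f) (substTs-swap x α s u ts (λ y t∈ts o → only y (arg t∈ts o)))

    substTs-swap : ∀ x α s u (ts : List (Term Fun))
                 → (∀ y {t} → t ∈ ts → y occursInT t → y ≡ x)
                 → substTs α s (substTs x u ts) ≡ substTs x (substT α s u) ts
    substTs-swap x α s u [] _ = refl
    substTs-swap x α s u (t ∷ ts) only =
      cong₂ _∷_ (substT-swap x α s u t (λ y → only y (here refl)))
                (substTs-swap x α s u ts (λ y t∈ts → only y (there t∈ts)))

module _ {Fun Pred : Set} where

  OnlyVar : ℕ → Formula Fun Pred → Set
  OnlyVar x A = ∀ y → y occursIn A → y ≡ x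

  subst-swap : ∀ x α s u (A : Formula Fun Pred) → OnlyVar x A
             → subst α s (subst x u A) ≡ subst x (substT α s u) A
  subst-swap x α s u (atom P ts) only =
    cong (atom P) (substTs-swap x α s u ts (λ y t∈ts o → only y (inAtom t∈ts o)))
  subst-swap x α s u ⊤ᶠ _ = refl
  subst-swap x α s u ⊥ᶠ _ = refl
  subst-swap x α s u (¬ᶠ A) only = cong ¬ᶠ_ (subst-swap x α s u A (λ y o → only y (in¬ o)))
  subst-swap x α s u (A ∧ᶠ B) only =
    cong₂ _∧ᶠ_ (subst-swap x α s u A (λ y o → only y (in∧ˡ o)))
               (subst-swap x α s u B (λ y o → only y (in∧ʳ o)))
  subst-swap x α s u (A ∨ᶠ B) only =
    cong₂ _∨ᶠ_ (subst-swap x α s u A (λ y o → only y (in∨ˡ o)))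
               (subst-swap x α s u B (λ y o → only y (in∨ʳ o)))
  subst-swap x α s u (A ⊃ᶠ B) only =
    cong₂ _⊃ᶠ_ (subst-swap x α s u A (λ y o → only y (in⊃ˡ o)))
               (subst-swap x α s u B (λ y o → only y (in⊃ʳ o)))

  instF-subst : ∀ x (A : Formula Fun Pred) → OnlyVar x A
              → ∀ bs c u → instF bs c (subst x u A) ≡ subst x (instT bs c u) A
  instF-subst x A only [] _ u = refl
  instF-subst x A only ((α , _) ∷ rest) ((s , _) , c) u =
    begin
      instF rest c (subst α s (subst x u A))
    ≡⟨ cong (instF rest c) (subst-swap x α s u A only) ⟩
      instF rest c (subst x (substT α s u) A)
    ≡⟨ instF-subst x A only rest c (substT α s u) ⟩
      subst x (instT rest c (substT α s u)) A
    ∎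

instances-selection : ∀ {Fun} bs (u t : Term Fun)
                    → t ∈ instances u bs → ∃[ c ] t ≡ instT bs c u
instances-selection [] u t (here refl) = tt , refl
instances-selection ((α , ss) ∷ rest) u t t∈
  with find (∈-concatMap⁻ (λ s → instances (substT α s u) rest) {xs = ss} t∈)
... | s , s∈ss , t∈rest with instances-selection rest (substT α s u) t t∈rest
... | c , t≡ = ((s , s∈ss) , c) , t≡

language-selection : ∀ {Fun} (us : List (Term Fun)) bs {t}
                   → t ∈ language us bs → ∃[ u ] u ∈ us × ∃[ c ] t ≡ instT bs c u
language-selection us bs {t} t∈
  with find (∈-concatMap⁻ (λ u → instances u bs) {xs = us} t∈)
... | u , u∈us , t∈inst = u , u∈us , instances-selection bs u t t∈inst

Cchain⇒language : ∀ {Fun Pred} (F : Formula Fun Pred) x → OnlyVar x F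
                → (us : List (Term Fun)) (bs : List (Block Fun)) {v : Valuation}
                → v ⊨ Cchain (C₁ F x us) bs
                → v ⊨ ⋀ (map (λ t → subst x t F) (language us bs))
Cchain⇒language F x only us bs {v} h = ⊨-⋀⁺ _ instance-holds
  where
  instance-holds : ∀ {D} → D ∈ map (λ t → subst x t F) (language us bs) → v ⊨ D
  instance-holds D∈ with ∈-map⁻ (λ t → subst x t F) D∈
  ... | t , t∈L , refl with language-selection us bs t∈L
  ... | u , u∈us , c , refl =
    transport (v ⊨_) (instF-subst x F only bs c u)
      (⊨-instF-⋀⁻ bs c (map (λ u′ → subst x u′ F) us)
        (Cchain-sound bs (C₁ F x us) h c) (∈-map⁺ (λ u′ → subst x u′ F) u∈us))

lemma2 : {Fun Pred : Set} (F : Formula Fun Pred) (x : ℕ)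
         → (∀ y → y occursIn F → y ≡ x)
         → (us : List (Term Fun)) (bs : List (Block Fun))
         → IsSchematicHerbrand F x us bs
         → TautAnte (Cchain (C₁ F x us) bs)
lemma2 F x only us bs H v =
  ¬-not λ C-holds →
    not-¬ (IsSchematicHerbrand.taut H v) (Cchain⇒language F x only us bs C-holds)
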